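{- Let $E$ be a finite set and let $f:2^E\to\mathbb{R}$ be a set function with $f(\emptyset)=0$. Then $(E,f)$ is a polymatroid if and only if, for every family $\mathcal{H}\subseteq 2^E$ with $\emptyset,E\in\mathcal{H}$, $f$ is $\mathcal{H}$-submodular, i.e. for all $X,Y\in 2^E$ and all $H_1,H_2\in\mathcal{H}$ with $H_1\subseteq H_2$, $H_1\subseteq X\cap Y$ and $H_2\subseteq X\cup Y$, one has $f(H_1)+f(H_2)\le f(X)+f(Y)$.
   Context: A polymatroid is a pair $(E,f)$ of a finite set $E$ and a set function $f:2^E\to\mathbb{R}$ satisfying (i) $f(\emptyset)=0$; (ii) $X\subseteq Y$ implies $f(X)\le f(Y)$; (iii) $f(X)+f(Y)\ge f(X\cap Y)+f(X\cup Y)$ for all $X,Y\in 2^E$. -}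

module Defs where

open import Data.Nat using (ℕ)
open import Data.Fin.Subset using (Subset; ⊥; ⊤; _⊆_; _∩_; _∪_)
open import Data.Product using (Σ; ∃; _×_)
open import Relation.Binary.PropositionalEquality using (_≡_; _≢_)
open import Relation.Binary.Structures using (IsTotalOrder)
open import Algebra.Structures using (IsCommutativeRing)

-- An abstract model of the real numbers: a Dedekind-complete totally
-- ordered field (the standard axiomatization of ℝ).
record RealField : Set₁ where
  infixl 6 _+_
  infixl 7 _*_
  infix 4 _≤_
  field
    Carrier : Set
    _+_ _*_ : Carrier → Carrier → Carrier
    -_ : Carrier → Carrier
    0# 1# : Carrier
    _≤_ : Carrier → Carrier → Set
    isCommutativeRing : IsCommutativeRing _≡_ _+_ _*_ -_ 0# 1#
    0≢1 : 0# ≢ 1#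
    inverse : ∀ x → x ≢ 0# → Σ Carrier (λ y → x * y ≡ 1#)
    isTotalOrder : IsTotalOrder _≡_ _≤_
    +-mono-≤ : ∀ {x y} z → x ≤ y → x + z ≤ y + z
    *-nonneg : ∀ {x y} → 0# ≤ x → 0# ≤ y → 0# ≤ x * y
    complete : ∀ (P : Carrier → Set) → Σ Carrier P →
               Σ Carrier (λ b → ∀ x → P x → x ≤ b) →
               Σ Carrier (λ s → (∀ x → P x → x ≤ s) ×
                                (∀ b → (∀ x → P x → x ≤ b) → s ≤ b))

-- The ground set E is Fin n; 2^E is Subset n; f : 2^E → ℝ.
module _ (R : RealField) where
  open RealField R

  record IsPolymatroid (n : ℕ) (f : Subset n → Carrier) : Set where
    field
      normalized : f ⊥ ≡ 0#
      monotone   : ∀ X Y → X ⊆ Y → f X ≤ f Y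
      submodular : ∀ X Y → f (X ∩ Y) + f (X ∪ Y) ≤ f X + f Y

  HSubmodular : (n : ℕ) → (Subset n → Set) → (Subset n → Carrier) → Set
  HSubmodular n 𝓗 f =
    ∀ (X Y H₁ H₂ : Subset n) → 𝓗 H₁ → 𝓗 H₂ →
    H₁ ⊆ H₂ → H₁ ⊆ X ∩ Y → H₂ ⊆ X ∪ Y →
    f H₁ + f H₂ ≤ f X + f Y

module Submission where

-- A polymatroid is 𝓗-submodular for every 𝓗 because monotonicity pushes f H₁ and f H₂
-- up to f (X ∩ Y) and f (X ∪ Y), after which submodularity applies.  Conversely, taking
-- 𝓗 = 2^E, the choice H₁ = X ∩ Y, H₂ = X ∪ Y gives submodularity, and
-- (X, Y, H₁, H₂) = (Y, ∅, ∅, X) with X ⊆ Y gives f ∅ + f X ≤ f Y + f ∅, i.e. monotonicity.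

open import Defs
open import Data.Nat using (ℕ)
open import Data.Fin.Subset using (Subset; ⊥; ⊤; _⊆_; _∩_; _∪_)
open import Data.Fin.Subset.Properties using (⊥⊆; ⊆-refl; ⊆-trans; p∩q⊆p; p⊆p∪q)
open import Data.Product using (_×_; _,_)
open import Data.Unit using (tt) renaming (⊤ to Unit)
open import Relation.Binary.PropositionalEquality using (_≡_; refl; subst₂; cong; module ≡-Reasoning)
open import Relation.Binary.Structures using (IsTotalOrder)
open import Algebra.Structures using (IsCommutativeRing)

allSubsets : ∀ {n} → Subset n → Set
allSubsets _ = Unit

module _ (R : RealField) where
  open RealField R
  open IsCommutativeRing isCommutativeRing
    using (+-comm; +-assoc; +-identityʳ; -‿inverseʳ)
  open IsTotalOrder isTotalOrder using (trans)

  +-mono₂-≤ : ∀ {a b c d} → a ≤ b → c ≤ d → a + c ≤ b + d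
  +-mono₂-≤ {a} {b} {c} {d} a≤b c≤d =
    trans (+-mono-≤ c a≤b) (subst₂ _≤_ (+-comm c b) (+-comm d b) (+-mono-≤ b c≤d))

  +-cancelʳ-≤ : ∀ {a b} c → a + c ≤ b + c → a ≤ b
  +-cancelʳ-≤ {a} {b} c a+c≤b+c =
    subst₂ _≤_ (+-c-cancels a) (+-c-cancels b) (+-mono-≤ (- c) a+c≤b+c)
    where
    open ≡-Reasoning
    +-c-cancels : ∀ x → x + c + - c ≡ x
    +-c-cancels x = begin
      x + c + - c    ≡⟨ +-assoc x c (- c) ⟩
      x + (c + - c)  ≡⟨ cong (x +_) (-‿inverseʳ c) ⟩
      x + 0#         ≡⟨ +-identityʳ x ⟩
      x              ∎

  module _ {n : ℕ} {f : Subset n → Carrier} where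

    polymatroid⇒HSubmodular : IsPolymatroid R n f → ∀ 𝓗 → HSubmodular R n 𝓗 f
    polymatroid⇒HSubmodular P 𝓗 X Y H₁ H₂ _ _ _ H₁⊆X∩Y H₂⊆X∪Y =
      trans (+-mono₂-≤ (monotone H₁ (X ∩ Y) H₁⊆X∩Y) (monotone H₂ (X ∪ Y) H₂⊆X∪Y))
            (submodular X Y)
      where open IsPolymatroid P

    HSubmodular-allSubsets⇒monotone :
      HSubmodular R n allSubsets f → ∀ X Y → X ⊆ Y → f X ≤ f Y
    HSubmodular-allSubsets⇒monotone Hs X Y X⊆Y =
      +-cancelʳ-≤ (f ⊥) (subst₂ _≤_ (+-comm (f ⊥) (f X)) refl
        (Hs Y ⊥ ⊥ X tt tt ⊥⊆ ⊥⊆ (⊆-trans X⊆Y (p⊆p∪q ⊥))))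

    HSubmodular-allSubsets⇒submodular :
      HSubmodular R n allSubsets f → ∀ X Y → f (X ∩ Y) + f (X ∪ Y) ≤ f X + f Y
    HSubmodular-allSubsets⇒submodular Hs X Y =
      Hs X Y (X ∩ Y) (X ∪ Y) tt tt (⊆-trans (p∩q⊆p X Y) (p⊆p∪q Y)) ⊆-refl ⊆-refl

proposition4p4 : (R : RealField) (n : ℕ) (f : Subset n → RealField.Carrier R) →
    f ⊥ ≡ RealField.0# R →
    (IsPolymatroid R n f →
      ((𝓗 : Subset n → Set) → 𝓗 ⊥ → 𝓗 ⊤ → HSubmodular R n 𝓗 f))
    × (((𝓗 : Subset n → Set) → 𝓗 ⊥ → 𝓗 ⊤ → HSubmodular R n 𝓗 f) →
      IsPolymatroid R n f)
proposition4p4 R n f f⊥≡0 =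
  (λ P 𝓗 _ _ → polymatroid⇒HSubmodular R P 𝓗) ,
  λ H → let Hs = H allSubsets tt tt in record
    { normalized = f⊥≡0
    ; monotone   = HSubmodular-allSubsets⇒monotone R Hs
    ; submodular = HSubmodular-allSubsets⇒submodular R Hs
    }
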